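{- Let $A$ be a set with a decidable total order $\le$. Then there is a section $s\colon M(A)\to L(A)$ of $q$ satisfying is-head-least such that for all $x,y:A$, $x\le_s y$ if and only if $x\le y$.
   Context: Univalent type theory. A total order is a proposition-valued reflexive, transitive, antisymmetric, total relation; decidable if $(x\le y)+\neg(x\le y)$ for all $x,y$. $L(A)$ is the free monoid on $A$ (finite lists), $M(A)$ the free commutative monoid (finite multisets) with generators $\eta_A$, $\langle x,y\rangle=\eta_A(x)\cdot\eta_A(y)$, $q$ the monoid homomorphism $L(A)\to M(A)$ extending $\eta_A$; a section is $s$ with $q\circ s=\mathrm{id}$. $\mathrm{head}\colon L(A)\to1+A$ returns $\mathrm{inl}(\ast)$ on $[]$ and $\mathrm{inr}(x)$ on $x::xs$; $x\le_s y$ means $\mathrm{head}(s(\langle x,y\rangle))=\mathrm{inr}(x)$. $xs\in\mathrm{im}(s)$ means there merely exists $ys$ with $s(ys)=xs$; $y\in xs$ means $y$ equals some entry of the list $xs$. is-head-least: for all $x,y,xs$, $y\in x::xs$ and $x::xs\in\mathrm{im}(s)$ imply $[x,y]\in\mathrm{im}(s)$. -}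

module Defs where

open import Level using (Level; suc; _⊔_; 0ℓ)
open import Data.Unit using (⊤; tt)
open import Data.Sum using (_⊎_; inj₁; inj₂)
open import Data.Product using (Σ; _×_; _,_)
open import Data.List using (List; []; _∷_)
open import Data.List.Membership.Propositional using (_∈_)
open import Data.List.Relation.Binary.Permutation.Propositional using (_↭_)
open import Relation.Binary.PropositionalEquality using (_≡_)
open import Relation.Nullary using (¬_)

isProp : ∀ {a} → Set a → Set a
isProp P = (p q : P) → p ≡ q

isSet : ∀ {a} → Set a → Set a
isSet X = {x y : X} → isProp (x ≡ y)

-- Propositional truncation (impredicative encoding; no HITs available)
∥_∥ : Set → Set₁
∥ X ∥ = (P : Set) → isProp P → (X → P) → P

record IsDecTotalOrder {A : Set} (_≤_ : A → A → Set) : Set₁ where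
  field
    ≤-prop    : ∀ x y → isProp (x ≤ y)
    ≤-refl    : ∀ x → x ≤ x
    ≤-trans   : ∀ x y z → x ≤ y → y ≤ z → x ≤ z
    ≤-antisym : ∀ x y → x ≤ y → y ≤ x → x ≡ y
    ≤-total   : ∀ x y → ∥ (x ≤ y) ⊎ (y ≤ x) ∥
    ≤-dec     : ∀ x y → (x ≤ y) ⊎ ¬ (x ≤ y)

-- M(A) is modelled as the quotient of List A by permutation
-- (_↭_), encoded as a setoid: q : L(A) → M(A) is the quotient map, so a map
-- s : M(A) → L(A) is a function on lists that respects _↭_, and
-- q ∘ s = id means  s xs ↭ xs  for every representative xs.
record Section (A : Set) : Set where
  field
    s        : List A → List A
    s-resp   : ∀ {xs ys} → xs ↭ ys → s xs ≡ s ys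
    s-section : ∀ xs → s xs ↭ xs
open Section public

-- ⟨ x , y ⟩ = η x · η y, represented by the list [x , y]
⟨_,_⟩ : {A : Set} → A → A → List A
⟨ x , y ⟩ = x ∷ y ∷ []

head : {A : Set} → List A → ⊤ ⊎ A
head []       = inj₁ tt
head (x ∷ _)  = inj₂ x

_≤[_]_ : {A : Set} → A → Section A → A → Set
x ≤[ σ ] y = head (s σ ⟨ x , y ⟩) ≡ inj₂ x

InIm : {A : Set} → Section A → List A → Set₁
InIm σ xs = ∥ Σ _ (λ ys → s σ ys ≡ xs) ∥

is-head-least : {A : Set} → Section A → Set₁
is-head-least {A} σ =
  ∀ (x y : A) (xs : List A) → y ∈ (x ∷ xs) → InIm σ (x ∷ xs) → InIm σ (x ∷ y ∷ [])

-- Take s to be insertion sort along ≤.  Sorting is a section of the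
-- quotient map because two sorted permutations of one another coincide,
-- and the head of a sorted list is its least entry, which gives both
-- is-head-least and the identification of ≤ₛ with ≤.
module Submission where

open import Defs
open import Data.Product using (Σ; _×_; _,_)
open import Data.Sum using (_⊎_; inj₁; inj₂)
open import Data.Sum.Properties using (inj₂-injective)
open import Data.List using ([]; _∷_)
open import Data.List.Membership.Propositional using (_∈_)
open import Data.List.Relation.Unary.All using (lookup)
open import Data.List.Relation.Unary.Linked.Properties using (Linked⇒All)
open import Data.List.Relation.Unary.Sorted.TotalOrder using (Sorted)
open import Data.List.Relation.Unary.Sorted.TotalOrder.Properties using (↗↭↗⇒≋)
open import Data.List.Relation.Binary.Permutation.Propositional
  using (_↭_; ↭-sym; ↭-trans; ↭⇒↭ₛ)
open import Data.List.Relation.Binary.Pointwise using (Pointwise-≡⇒≡)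
open import Function.Bundles using (_⇔_; mk⇔)
open import Level using (Level)
open import Relation.Binary.Core using (Rel)
open import Relation.Binary.Bundles using (DecTotalOrder)
import Relation.Binary.Structures as Std
open import Relation.Binary.PropositionalEquality
  using (_≡_; refl; sym; cong; subst; isEquivalence)
open import Relation.Nullary using (Dec; yes; no; contradiction)
import Data.List.Sort.InsertionSort.Base as InsertionSort
import Data.List.Sort.InsertionSort.Properties as InsertionSortProperties

module SortByDecTotalOrder
  {ℓ : Level} {A : Set} {_≤_ : Rel A ℓ}
  (isDecTotalOrder : Std.IsDecTotalOrder _≡_ _≤_)
  where

  private
    O : DecTotalOrder _ _ ℓ
    O = record { isDecTotalOrder = isDecTotalOrder }

  open DecTotalOrder O using (totalOrder; _≤?_; trans; reflexive)
  open InsertionSort O public using (sort)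
  open InsertionSortProperties O public using (sort-↭)
  open InsertionSortProperties O using (sort-↗)

  sort-cong-↭ : ∀ {xs ys} → xs ↭ ys → sort xs ≡ sort ys
  sort-cong-↭ {xs} {ys} xs↭ys = Pointwise-≡⇒≡
    (↗↭↗⇒≋ totalOrder (sort-↗ xs) (sort-↗ ys)
      (↭⇒↭ₛ (↭-trans (sort-↭ xs) (↭-trans xs↭ys (↭-sym (sort-↭ ys))))))

  sort-head-least : ∀ {x y xs} ys → sort ys ≡ x ∷ xs → y ∈ x ∷ xs → x ≤ y
  sort-head-least ys sort-ys≡ y∈ =
    lookup (Linked⇒All trans (reflexive refl) (subst (Sorted totalOrder) sort-ys≡ (sort-↗ ys))) y∈

  sort-pair-≤ : ∀ {x y} → x ≤ y → sort (x ∷ y ∷ []) ≡ x ∷ y ∷ []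
  sort-pair-≤ {x} {y} x≤y with x ≤? y
  ... | yes _  = refl
  ... | no x≰y = contradiction x≤y x≰y

  head-sort-pair : ∀ {x y} → head (sort (x ∷ y ∷ [])) ≡ inj₂ x → x ≤ y
  head-sort-pair {x} {y} head≡x with x ≤? y
  ... | yes x≤y = x≤y
  -- here sort (x ∷ y ∷ []) computes to y ∷ x ∷ [], so head≡x : inj₂ y ≡ inj₂ x
  ... | no _    = reflexive (sym (inj₂-injective head≡x))

module _ {A : Set} {_≤_ : A → A → Set} (O : IsDecTotalOrder _≤_) where
  open IsDecTotalOrder O

  _≤?_ : ∀ x y → Dec (x ≤ y)
  x ≤? y with ≤-dec x y
  ... | inj₁ x≤y = yes x≤y
  ... | inj₂ x≰y = no x≰y

  -- Once x ≤ y is excluded, the truncation can be eliminated into the proposition y ≤ x.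
  ≤-total-untruncated : ∀ x y → (x ≤ y) ⊎ (y ≤ x)
  ≤-total-untruncated x y with ≤-dec x y
  ... | inj₁ x≤y = inj₁ x≤y
  ... | inj₂ x≰y = inj₂ (≤-total x y (y ≤ x) (≤-prop y x) λ
    { (inj₁ x≤y) → contradiction x≤y x≰y
    ; (inj₂ y≤x) → y≤x })

  _≟_ : ∀ (x y : A) → Dec (x ≡ y)
  x ≟ y with x ≤? y | y ≤? x
  ... | yes x≤y | yes y≤x = yes (≤-antisym x y x≤y y≤x)
  ... | no x≰y  | _       = no λ { refl → x≰y (≤-refl x) }
  ... | _       | no y≰x  = no λ { refl → y≰x (≤-refl x) }

  isStdDecTotalOrder : Std.IsDecTotalOrder _≡_ _≤_
  isStdDecTotalOrder = record
    { isTotalOrder = record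
      { isPartialOrder = record
        { isPreorder = record
          { isEquivalence = isEquivalence
          ; reflexive = λ { {x} refl → ≤-refl x }
          ; trans = λ {x} {y} {z} → ≤-trans x y z
          }
        ; antisym = λ {x} {y} → ≤-antisym x y
        }
      ; total = ≤-total-untruncated
      }
    ; _≟_ = _≟_
    ; _≤?_ = _≤?_
    }

  open SortByDecTotalOrder isStdDecTotalOrder

  sortSection : Section A
  sortSection = record { s = sort ; s-resp = sort-cong-↭ ; s-section = sort-↭ }

  sortSection-is-head-least : is-head-least sortSection
  sortSection-is-head-least x y xs y∈ im _ _ in-image = in-image (x ∷ y ∷ [] , sort-pair-≤ x≤y)
    where
    x≤y : x ≤ y
    x≤y = im (x ≤ y) (≤-prop x y) λ { (ys , sort-ys≡) → sort-head-least ys sort-ys≡ y∈ }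

  ≤[sortSection]⇔≤ : ∀ x y → (x ≤[ sortSection ] y) ⇔ (x ≤ y)
  ≤[sortSection]⇔≤ x y = mk⇔ head-sort-pair (λ x≤y → cong head (sort-pair-≤ x≤y))

proposition62 : (A : Set) → isSet A → (_≤_ : A → A → Set) → IsDecTotalOrder _≤_ →
    Σ (Section A) (λ σ → is-head-least σ × (∀ x y → (x ≤[ σ ] y) ⇔ (x ≤ y)))
proposition62 A _ _≤_ O = sortSection O , sortSection-is-head-least O , ≤[sortSection]⇔≤ O
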